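{- Let $1\le k\le n-1$. All elements of $\Theta_{k,n}$ belong to a single conjugacy class of the group $\tilde S_n$.
   Context: $\tilde S_n$ is the group, under composition, of bijections $f:\mathbb{Z}\to\mathbb{Z}$ with $f(i+n)=f(i)+n$ for all $i$. For such $f$, $\bar f$ is the induced permutation of $\mathbb{Z}/n\mathbb{Z}$. $\Theta_{k,n}$ is the set of $f\in\tilde S_n$ such that $i\le f(i)\le i+n$ for all $i$, $\sum_{i=1}^n(f(i)-i)=kn$, and $\bar f$ is an $n$-cycle. -}

module Defs where

open import Data.Nat as ℕ using (ℕ; zero; suc; NonZero)
open import Data.Integer using (ℤ; +_; _+_; _-_; _*_; _≤_; _%ℕ_)
open import Data.Integer.DivMod using (n%ℕd<d)
open import Data.Fin using (Fin; toℕ; fromℕ<)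
open import Data.Product using (Σ; ∃; _×_)
open import Relation.Binary.PropositionalEquality using (_≡_)

record AffinePerm (n : ℕ) : Set where
  field
    fun      : ℤ → ℤ
    inv      : ℤ → ℤ
    inv-left  : ∀ i → inv (fun i) ≡ i
    inv-right : ∀ i → fun (inv i) ≡ i
    periodic : ∀ i → fun (i + + n) ≡ fun i + + n
open AffinePerm public

_∘ₐ_ : ∀ {n} → AffinePerm n → AffinePerm n → ℤ → ℤ
(f ∘ₐ g) i = fun f (fun g i)

Conjugate : ∀ {n} → AffinePerm n → AffinePerm n → Set
Conjugate {n} f h = Σ (AffinePerm n) λ g → ∀ i → fun g (fun f i) ≡ fun h (fun g i)

-- The induced permutation f̄ of ℤ/nℤ, with ℤ/nℤ represented by Fin n
-- (residue r ↦ class of r).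
bar : ∀ {n} .{{_ : NonZero n}} → AffinePerm n → Fin n → Fin n
bar {n} f a = fromℕ< (n%ℕd<d (fun f (+ toℕ a)) n)

iter : ∀ {A : Set} → (A → A) → ℕ → A → A
iter σ zero    a = a
iter σ (suc m) a = σ (iter σ m a)

-- A permutation σ of an n-element set Fin n is an n-cycle iff it has a single
-- orbit (of size n), i.e. every element is reached from every other by iterating σ.
IsNCycle : ∀ {n} → (Fin n → Fin n) → Set
IsNCycle {n} σ = ∀ a b → ∃ λ m → iter σ m a ≡ b

sumFrom1 : ℕ → (ℤ → ℤ) → ℤ
sumFrom1 zero    g = + 0
sumFrom1 (suc m) g = sumFrom1 m g + g (+ suc m)

InTheta : (k n : ℕ) .{{_ : NonZero n}} → AffinePerm n → Set
InTheta k n f =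
  (∀ i → (i ≤ fun f i) × (fun f i ≤ i + + n))
  × (sumFrom1 n (λ i → fun f i - i) ≡ + k * + n)
  × IsNCycle (bar f)

-- Let a_j = f^j(0) for 0 ≤ j < n. Since f̄ is an n-cycle, the a_j represent every residue
-- class mod n exactly once, so every integer is uniquely a_j + t n. The displacement
-- f(i) − i is n-periodic, so summing it over one period is the same as summing it along the
-- orbit 0, f(0), …, f^(n−1)(0), which telescopes to f^n(0); hence f^n(0) = k n for f ∈ Θ_{k,n}.
-- Writing b_j = h^j(0), the map g(a_j + t n) = b_j + t n lies in S̃ₙ, and g f = h g: both f
-- and h move the j-th orbit point to the (j+1)-th one, except the last, which goes to
-- f^n(0) = k n = h^n(0).
module Submission where

open import Defs
open import Data.Nat.Base as ℕ using (ℕ; zero; suc; NonZero; _≤_; _<_; _∸_; _%_)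
import Data.Nat.Properties as ℕ
open import Data.Nat.DivMod using (m≡m%n+[m/n]*n; m%n<n; n%n≡0)
open import Data.Nat.Divisibility using (divides; >⇒∤) renaming (_∣_ to _∣ℕ_)
open import Data.Integer.Base using (ℤ; +_; -[1+_]; _+_; _-_; _*_; -_; _%ℕ_; _/ℕ_; ∣_∣)
import Data.Integer.Properties as ℤ
open import Data.Integer.DivMod using (n%ℕd<d; a≡a%ℕn+[a/ℕn]*n)
open import Data.Integer.Tactic.RingSolver using (solve-∀)
open import Data.Fin.Base using (Fin; toℕ; fromℕ; fromℕ<)
import Data.Fin.Properties as Fin
open import Data.Fin.Permutation using (Permutation′; permutation; _⟨$⟩ˡ_; inverseˡ; inverseʳ)
open import Algebra.Properties.CommutativeMonoid.Sum ℤ.+-0-commutativeMonoid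
  using (sum; sum-init-last; sum-cong-≗; sum-permute)
open import Data.Vec.Functional using (init; last)
open import Function.Base using (_∘_)
open import Data.Product.Base using (∃; _,_; proj₁; proj₂)
open import Data.Sum.Base using (inj₁; inj₂)
open import Relation.Binary.Definitions using (tri<; tri≈; tri>)
open import Relation.Binary.PropositionalEquality
open import Relation.Nullary.Negation using (contradiction)

open ≡-Reasoning

module Residues (n : ℕ) .{{_ : NonZero n}} where

  residue : ℤ → Fin n
  residue x = fromℕ< (n%ℕd<d x n)

  toℕ-residue : ∀ x → toℕ (residue x) ≡ x %ℕ n
  toℕ-residue x = Fin.toℕ-fromℕ< (n%ℕd<d x n)

  multiple-<⇒≡0 : ∀ {m} → n ∣ℕ m → m < n → m ≡ 0
  multiple-<⇒≡0 {zero}  _   _   = refl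
  multiple-<⇒≡0 {suc m} n∣m m<n = contradiction n∣m (>⇒∤ m<n)

  remainder-unique : ∀ {r r′} q q′ → r < n → r′ < n → + r + q * + n ≡ + r′ + q′ * + n → r ≡ r′
  remainder-unique {r} {r′} q q′ r<n r′<n eq =
    ℤ.+-injective (ℤ.i-j≡0⇒i≡j (+ r) (+ r′) (ℤ.∣i∣≡0⇒i≡0 (multiple-<⇒≡0 n∣∣r-r′∣ ∣r-r′∣<n)))
    where
    difference : ∀ a b q q′ d → a + q * d ≡ b + q′ * d → a - b ≡ (q′ - q) * d
    difference a b q q′ d e = begin
      a - b                         ≡⟨ lhs a b (q * d) ⟩
      (a + q * d) - (b + q * d)     ≡⟨ cong (_- (b + q * d)) e ⟩
      (b + q′ * d) - (b + q * d)    ≡⟨ rhs b q q′ d ⟩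
      (q′ - q) * d                  ∎
      where
      lhs : ∀ a b c → a - b ≡ (a + c) - (b + c)
      lhs = solve-∀
      rhs : ∀ b q q′ d → (b + q′ * d) - (b + q * d) ≡ (q′ - q) * d
      rhs = solve-∀
    n∣∣r-r′∣ : n ∣ℕ ∣ + r - + r′ ∣
    n∣∣r-r′∣ = divides ∣ q′ - q ∣
      (trans (cong ∣_∣ (difference (+ r) (+ r′) q q′ (+ n) eq)) (ℤ.abs-* (q′ - q) (+ n)))
    ∣r-r′∣<n : ∣ + r - + r′ ∣ < n
    ∣r-r′∣<n = ℕ.≤-<-trans (ℕ.≤-reflexive (cong ∣_∣ (ℤ.m-n≡m⊖n r r′)))
                 (ℕ.≤-<-trans (ℤ.∣m⊝n∣≤m⊔n r r′) (ℕ.⊔-lub r<n r′<n))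

  %ℕ-+* : ∀ x t → (x + t * + n) %ℕ n ≡ x %ℕ n
  %ℕ-+* x t = sym (remainder-unique (x /ℕ n + t) ((x + t * + n) /ℕ n)
    (n%ℕd<d x n) (n%ℕd<d (x + t * + n) n) (begin
      + (x %ℕ n) + (x /ℕ n + t) * + n          ≡⟨ regroup (+ (x %ℕ n)) (x /ℕ n) t (+ n) ⟩
      (+ (x %ℕ n) + (x /ℕ n) * + n) + t * + n  ≡⟨ cong (_+ t * + n) (a≡a%ℕn+[a/ℕn]*n x n) ⟨
      x + t * + n                              ≡⟨ a≡a%ℕn+[a/ℕn]*n (x + t * + n) n ⟩
      + ((x + t * + n) %ℕ n) + ((x + t * + n) /ℕ n) * + n ∎))
    where
    regroup : ∀ r q t d → r + (q + t) * d ≡ (r + q * d) + t * d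
    regroup = solve-∀

  residue-+* : ∀ x t → residue (x + t * + n) ≡ residue x
  residue-+* x t = Fin.toℕ-injective (begin
    toℕ (residue (x + t * + n)) ≡⟨ toℕ-residue (x + t * + n) ⟩
    (x + t * + n) %ℕ n          ≡⟨ %ℕ-+* x t ⟩
    x %ℕ n                      ≡⟨ toℕ-residue x ⟨
    toℕ (residue x)             ∎)

  x≡residue+quotient : ∀ x → x ≡ + toℕ (residue x) + (x /ℕ n) * + n
  x≡residue+quotient x =
    trans (a≡a%ℕn+[a/ℕn]*n x n) (cong (λ r → + r + (x /ℕ n) * + n) (sym (toℕ-residue x)))

  residue-≡⇒≡+* : ∀ {x y} → residue x ≡ residue y → x ≡ y + (x /ℕ n - y /ℕ n) * + n
  residue-≡⇒≡+* {x} {y} eq = begin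
    x                                            ≡⟨ x≡residue+quotient x ⟩
    + toℕ (residue x) + (x /ℕ n) * + n            ≡⟨ cong (λ r → + toℕ r + (x /ℕ n) * + n) eq ⟩
    + toℕ (residue y) + (x /ℕ n) * + n            ≡⟨ regroup (+ toℕ (residue y)) (x /ℕ n) (y /ℕ n) (+ n) ⟩
    (+ toℕ (residue y) + (y /ℕ n) * + n) + (x /ℕ n - y /ℕ n) * + n
                                                 ≡⟨ cong (_+ (x /ℕ n - y /ℕ n) * + n) (x≡residue+quotient y) ⟨
    y + (x /ℕ n - y /ℕ n) * + n                  ∎
    where
    regroup : ∀ r a b d → r + a * d ≡ (r + b * d) + (a - b) * d
    regroup = solve-∀

module AffinePermProperties {n : ℕ} .{{_ : NonZero n}} (f : AffinePerm n) where
  open Residues n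

  fun-+ℕ* : ∀ x m → fun f (x + + m * + n) ≡ fun f x + + m * + n
  fun-+ℕ* x zero    = trans (cong (fun f) (ℤ.+-identityʳ x)) (sym (ℤ.+-identityʳ (fun f x)))
  fun-+ℕ* x (suc m) = begin
    fun f (x + (+ 1 + + m) * + n)   ≡⟨ cong (fun f) (peel x (+ m) (+ n)) ⟩
    fun f ((x + + m * + n) + + n)   ≡⟨ periodic f (x + + m * + n) ⟩
    fun f (x + + m * + n) + + n     ≡⟨ cong (_+ + n) (fun-+ℕ* x m) ⟩
    (fun f x + + m * + n) + + n     ≡⟨ peel (fun f x) (+ m) (+ n) ⟨
    fun f x + (+ 1 + + m) * + n     ∎
    where
    peel : ∀ x m d → x + (+ 1 + m) * d ≡ (x + m * d) + d
    peel = solve-∀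

  fun-+* : ∀ x t → fun f (x + t * + n) ≡ fun f x + t * + n
  fun-+* x (+ m)     = fun-+ℕ* x m
  fun-+* x -[1+ m ] = begin
    fun f y                                   ≡⟨ add-sub (fun f y) s (+ n) ⟩
    (fun f y + s * + n) + (- s) * + n         ≡⟨ cong (_+ (- s) * + n) (fun-+ℕ* y (suc m)) ⟨
    fun f (y + s * + n) + (- s) * + n         ≡⟨ cong (λ z → fun f z + (- s) * + n) (sub-add x s (+ n)) ⟩
    fun f x + (- s) * + n                     ∎
    where
    s = + suc m
    y = x + (- s) * + n
    add-sub : ∀ a s d → a ≡ (a + s * d) + (- s) * d
    add-sub = solve-∀
    sub-add : ∀ a s d → (a + (- s) * d) + s * d ≡ a
    sub-add = solve-∀

  fun≡fun-residue+quotient : ∀ x → fun f x ≡ fun f (+ toℕ (residue x)) + (x /ℕ n) * + n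
  fun≡fun-residue+quotient x =
    trans (cong (fun f) (x≡residue+quotient x)) (fun-+* (+ toℕ (residue x)) (x /ℕ n))

  residue-fun : ∀ x → residue (fun f x) ≡ bar f (residue x)
  residue-fun x =
    trans (cong residue (fun≡fun-residue+quotient x)) (residue-+* (fun f (+ toℕ (residue x))) (x /ℕ n))

  residue-iter : ∀ m x → residue (iter (fun f) m x) ≡ iter (bar f) m (residue x)
  residue-iter zero    x = refl
  residue-iter (suc m) x = trans (residue-fun (iter (fun f) m x)) (cong (bar f) (residue-iter m x))

  displacement-residue : ∀ x → fun f x - x ≡ fun f (+ toℕ (residue x)) - + toℕ (residue x)
  displacement-residue x = begin
    fun f x - x                           ≡⟨ cong₂ _-_ (fun≡fun-residue+quotient x) (x≡residue+quotient x) ⟩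
    (fun f ρ + q * + n) - (ρ + q * + n)   ≡⟨ cancel (fun f ρ) ρ q (+ n) ⟩
    fun f ρ - ρ                           ∎
    where
    ρ = + toℕ (residue x)
    q = x /ℕ n
    cancel : ∀ a b q d → (a + q * d) - (b + q * d) ≡ a - b
    cancel = solve-∀

module Iteration {A : Set} (σ : A → A) where

  iter-+ : ∀ a b x → iter σ (a ℕ.+ b) x ≡ iter σ a (iter σ b x)
  iter-+ zero    b x = refl
  iter-+ (suc a) b x = cong σ (iter-+ a b x)

  iter-comm : ∀ a b x → iter σ a (iter σ b x) ≡ iter σ b (iter σ a x)
  iter-comm a b x = begin
    iter σ a (iter σ b x)  ≡⟨ iter-+ a b x ⟨
    iter σ (a ℕ.+ b) x     ≡⟨ cong (λ k → iter σ k x) (ℕ.+-comm a b) ⟩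
    iter σ (b ℕ.+ a) x     ≡⟨ iter-+ b a x ⟩
    iter σ b (iter σ a x)  ∎

  iter-sucʳ : ∀ m x → iter σ (suc m) x ≡ iter σ m (σ x)
  iter-sucʳ m x = iter-comm 1 m x

  module _ {P x} (period : iter σ P x ≡ x) where

    iter-*-period : ∀ q → iter σ (q ℕ.* P) x ≡ x
    iter-*-period zero    = refl
    iter-*-period (suc q) = begin
      iter σ (P ℕ.+ q ℕ.* P) x      ≡⟨ iter-+ P (q ℕ.* P) x ⟩
      iter σ P (iter σ (q ℕ.* P) x) ≡⟨ cong (iter σ P) (iter-*-period q) ⟩
      iter σ P x                    ≡⟨ period ⟩
      x                             ∎

    module _ .{{_ : NonZero P}} where

      iter-%-period : ∀ m → iter σ m x ≡ iter σ (m % P) x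
      iter-%-period m = begin
        iter σ m x                                     ≡⟨ cong (λ k → iter σ k x) (m≡m%n+[m/n]*n m P) ⟩
        iter σ (m % P ℕ.+ (m ℕ./ P) ℕ.* P) x           ≡⟨ iter-+ (m % P) ((m ℕ./ P) ℕ.* P) x ⟩
        iter σ (m % P) (iter σ ((m ℕ./ P) ℕ.* P) x)    ≡⟨ cong (iter σ (m % P)) (iter-*-period (m ℕ./ P)) ⟩
        iter σ (m % P) x                               ∎

      -- σ need not be injective: on a periodic point, σ^(iP ∸ i) undoes σ^i.
      iter-cancel : ∀ {i j} → i ≤ j → iter σ i x ≡ iter σ j x → iter σ (j ∸ i) x ≡ x
      iter-cancel {i} {j} i≤j eq = begin
        iter σ (j ∸ i) x                              ≡⟨ cong (iter σ (j ∸ i)) undo ⟨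
        iter σ (j ∸ i) (iter σ c (iter σ i x))        ≡⟨ iter-comm (j ∸ i) c (iter σ i x) ⟩
        iter σ c (iter σ (j ∸ i) (iter σ i x))        ≡⟨ cong (iter σ c) (iter-+ (j ∸ i) i x) ⟨
        iter σ c (iter σ (j ∸ i ℕ.+ i) x)             ≡⟨ cong (λ k → iter σ c (iter σ k x)) (ℕ.m∸n+n≡m i≤j) ⟩
        iter σ c (iter σ j x)                         ≡⟨ cong (iter σ c) eq ⟨
        iter σ c (iter σ i x)                         ≡⟨ undo ⟩
        x                                             ∎
        where
        c = i ℕ.* P ∸ i
        undo : iter σ c (iter σ i x) ≡ x
        undo = begin
          iter σ c (iter σ i x)     ≡⟨ iter-+ c i x ⟨
          iter σ (c ℕ.+ i) x        ≡⟨ cong (λ k → iter σ k x) (ℕ.m∸n+n≡m (ℕ.m≤m*n i P)) ⟩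
          iter σ (i ℕ.* P) x        ≡⟨ iter-*-period i ⟩
          x                         ∎

module NCycle {n : ℕ} .{{_ : NonZero n}} {σ : Fin n → Fin n} (cycle : IsNCycle σ) (z : Fin n) where
  open Iteration σ

  orbit : Fin n → Fin n
  orbit j = iter σ (toℕ j) z

  reach-below : ∀ P .{{_ : NonZero P}} → iter σ P z ≡ z → ∀ b → ∃ λ (e : Fin P) → iter σ (toℕ e) z ≡ b
  reach-below P period b = fromℕ< (m%n<n m P) , (begin
    iter σ (toℕ (fromℕ< (m%n<n m P))) z ≡⟨ cong (λ k → iter σ k z) (Fin.toℕ-fromℕ< (m%n<n m P)) ⟩
    iter σ (m % P) z                    ≡⟨ iter-%-period period m ⟨
    iter σ m z                          ≡⟨ proj₂ (cycle z b) ⟩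
    b                                   ∎)
    where m = proj₁ (cycle z b)

  period-≥ : ∀ p .{{_ : NonZero p}} → iter σ p z ≡ z → n ≤ p
  period-≥ p period = ℕ.≮⇒≥ λ p<n →
    let (i , j , i<j , eq) = Fin.pigeonhole p<n (λ b → proj₁ (reach-below p period b))
    in ℕ.<⇒≢ i<j (cong toℕ (begin
      i                                             ≡⟨ proj₂ (reach-below p period i) ⟨
      iter σ (toℕ (proj₁ (reach-below p period i))) z ≡⟨ cong (λ e → iter σ (toℕ e) z) eq ⟩
      iter σ (toℕ (proj₁ (reach-below p period j))) z ≡⟨ proj₂ (reach-below p period j) ⟩
      j                                             ∎))

  return-time : ℕ
  return-time = suc (proj₁ (cycle (σ z) z))

  returns : iter σ return-time z ≡ z
  returns = trans (iter-sucʳ (proj₁ (cycle (σ z) z)) z) (proj₂ (cycle (σ z) z))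

  period-between : ∀ {i j} → i < j → iter σ i z ≡ iter σ j z → n ≤ j ∸ i
  period-between {i} {j} i<j eq =
    period-≥ (j ∸ i) {{ℕ.>-nonZero (ℕ.m<n⇒0<n∸m i<j)}}
      (iter-cancel {return-time} returns (ℕ.<⇒≤ i<j) eq)

  iter-n : iter σ n z ≡ z
  iter-n =
    let (i , j , i<j , eq) = Fin.pigeonhole (ℕ.n<1+n n) (λ (j : Fin (suc n)) → iter σ (toℕ j) z)
        j≤n = ℕ.s≤s⁻¹ (Fin.toℕ<n j)
        j∸i≡n = ℕ.≤-antisym (ℕ.≤-trans (ℕ.m∸n≤m (toℕ j) (toℕ i)) j≤n) (period-between i<j eq)
    in subst (λ k → iter σ k z ≡ z) j∸i≡n (iter-cancel {return-time} returns (ℕ.<⇒≤ i<j) eq)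

  orbit-<⇒≢ : ∀ {i j} → toℕ i < toℕ j → orbit i ≢ orbit j
  orbit-<⇒≢ {i} {j} i<j eq =
    ℕ.<⇒≱ (Fin.toℕ<n j) (ℕ.≤-trans (period-between i<j eq) (ℕ.m∸n≤m (toℕ j) (toℕ i)))

  orbit-injective : ∀ {i j} → orbit i ≡ orbit j → i ≡ j
  orbit-injective {i} {j} eq with Fin.<-cmp i j
  ... | tri< i<j _ _ = contradiction eq (orbit-<⇒≢ i<j)
  ... | tri≈ _ i≡j _ = i≡j
  ... | tri> _ _ j<i = contradiction (sym eq) (orbit-<⇒≢ j<i)

  orbit-index : Fin n → Fin n
  orbit-index r = proj₁ (reach-below n iter-n r)

  orbitPermutation : Permutation′ n
  orbitPermutation = permutation orbit orbit-index
    (λ r → proj₂ (reach-below n iter-n r))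
    (λ j → orbit-injective (proj₂ (reach-below n iter-n (orbit j))))

sumFrom1≡sum : ∀ m (g : ℤ → ℤ) → sumFrom1 m g ≡ sum {m} (λ i → g (+ suc (toℕ i)))
sumFrom1≡sum zero    g = refl
sumFrom1≡sum (suc m) g = begin
  sumFrom1 m g + g (+ suc m)
    ≡⟨ cong₂ _+_ (sumFrom1≡sum m g) (g-suc (sym (Fin.toℕ-fromℕ m))) ⟩
  sum {m} (λ i → g (+ suc (toℕ i))) + last t
    ≡⟨ cong (_+ last t) (sum-cong-≗ {m} λ i → g-suc (sym (Fin.toℕ-inject₁ i))) ⟩
  sum (init t) + last t
    ≡⟨ sum-init-last t ⟨
  sum t ∎
  where
  t : Fin (suc m) → ℤ
  t i = g (+ suc (toℕ i))
  g-suc : ∀ {k l} → k ≡ l → g (+ suc k) ≡ g (+ suc l)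
  g-suc = cong (λ k → g (+ suc k))

sumFrom1-periodic : ∀ m (g : ℤ → ℤ) → g (+ m) ≡ g (+ 0) → sumFrom1 m g ≡ sum {m} (λ i → g (+ toℕ i))
sumFrom1-periodic zero    g _       = refl
sumFrom1-periodic (suc m) g g-period = begin
  sumFrom1 m g + g (+ suc m)                   ≡⟨ cong (_+_ (sumFrom1 m g)) g-period ⟩
  sumFrom1 m g + g (+ 0)                       ≡⟨ ℤ.+-comm (sumFrom1 m g) (g (+ 0)) ⟩
  g (+ 0) + sumFrom1 m g                       ≡⟨ cong (_+_ (g (+ 0))) (sumFrom1≡sum m g) ⟩
  g (+ 0) + sum {m} (λ i → g (+ suc (toℕ i))) ∎

sum-telescope : ∀ m (a : ℕ → ℤ) → sum {m} (λ j → a (suc (toℕ j)) - a (toℕ j)) ≡ a m - a 0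
sum-telescope zero    a = sym (ℤ.+-inverseʳ (a 0))
sum-telescope (suc m) a = begin
  (a 1 - a 0) + sum {m} (λ j → a (suc (suc (toℕ j))) - a (suc (toℕ j)))
                                               ≡⟨ cong (_+_ (a 1 - a 0)) (sum-telescope m (a ∘ suc)) ⟩
  (a 1 - a 0) + (a (suc m) - a 1)              ≡⟨ ℤ.+-comm (a 1 - a 0) (a (suc m) - a 1) ⟩
  (a (suc m) - a 1) + (a 1 - a 0)              ≡⟨ ℤ.+-minus-telescope (a (suc m)) (a 1) (a 0) ⟩
  a (suc m) - a 0                              ∎

module Orbit {n : ℕ} .{{_ : NonZero n}} (f : AffinePerm n) (cycle : IsNCycle (bar f)) where
  open Residues n
  open AffinePermProperties f
  open NCycle cycle (residue (+ 0)) using (orbit; orbitPermutation; iter-n)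

  point : ℕ → ℤ
  point k = iter (fun f) k (+ 0)

  base : Fin n → ℤ
  base j = point (toℕ j)

  index : ℤ → Fin n
  index x = orbitPermutation ⟨$⟩ˡ residue x

  residue-base : ∀ j → residue (base j) ≡ orbit j
  residue-base j = residue-iter (toℕ j) (+ 0)

  index-unique : ∀ x {j} → residue x ≡ residue (base j) → index x ≡ j
  index-unique x {j} eq =
    trans (cong (orbitPermutation ⟨$⟩ˡ_) (trans eq (residue-base j))) (inverseˡ orbitPermutation)

  index-base-+* : ∀ j t → index (base j + t * + n) ≡ j
  index-base-+* j t = index-unique (base j + t * + n) (residue-+* (base j) t)

  layer : ℤ → ℤ
  layer x = x /ℕ n - base (index x) /ℕ n

  x≡base+layer*n : ∀ x → x ≡ base (index x) + layer x * + n
  x≡base+layer*n x = residue-≡⇒≡+* {x} {base (index x)}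
    (sym (trans (residue-base (index x)) (inverseʳ orbitPermutation)))

  coordinate-elim : (P : ℤ → Set) → (∀ j t → P (base j + t * + n)) → ∀ x → P x
  coordinate-elim P p x = subst P (sym (x≡base+layer*n x)) (p (index x) (layer x))

  origin : Fin n
  origin = fromℕ< (ℕ.>-nonZero⁻¹ n)

  base-origin : base origin ≡ + 0
  base-origin = cong point (Fin.toℕ-fromℕ< (ℕ.>-nonZero⁻¹ n))

  index-point-n-+* : ∀ t → index (point n + t * + n) ≡ origin
  index-point-n-+* t = index-unique (point n + t * + n) (begin
    residue (point n + t * + n)      ≡⟨ residue-+* (point n) t ⟩
    residue (point n)                ≡⟨ residue-iter n (+ 0) ⟩
    iter (bar f) n (residue (+ 0))   ≡⟨ iter-n ⟩
    residue (+ 0)                    ≡⟨ cong residue base-origin ⟨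
    residue (base origin)            ∎)

  base-suc : ∀ {j} (lt : suc (toℕ j) < n) → base (fromℕ< lt) ≡ fun f (base j)
  base-suc lt = cong point (Fin.toℕ-fromℕ< lt)

  sum-displacement : sumFrom1 n (λ i → fun f i - i) ≡ point n
  sum-displacement = begin
    sumFrom1 n d                                      ≡⟨ sumFrom1-periodic n d d-period ⟩
    sum {n} (λ r → d (+ toℕ r))                        ≡⟨ sum-permute (λ r → d (+ toℕ r)) orbitPermutation ⟩
    sum {n} (λ j → d (+ toℕ (orbit j)))                ≡⟨ sum-cong-≗ {n} (λ j → sym (d-orbit j)) ⟩
    sum {n} (λ j → point (suc (toℕ j)) - point (toℕ j)) ≡⟨ sum-telescope n point ⟩
    point n - + 0                                     ≡⟨ ℤ.+-identityʳ (point n) ⟩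
    point n                                           ∎
    where
    d : ℤ → ℤ
    d x = fun f x - x
    d-period : d (+ n) ≡ d (+ 0)
    d-period = trans (displacement-residue (+ n))
                     (cong (λ k → d (+ k)) (trans (toℕ-residue (+ n)) (n%n≡0 n)))
    d-orbit : ∀ j → d (base j) ≡ d (+ toℕ (orbit j))
    d-orbit j = trans (displacement-residue (base j)) (cong (λ r → d (+ toℕ r)) (residue-base j))

module Conjugation {n : ℕ} .{{_ : NonZero n}} (f h : AffinePerm n)
                   (cycle-f : IsNCycle (bar f)) (cycle-h : IsNCycle (bar h)) where
  open AffinePermProperties using (fun-+*)
  private
    module F = Orbit f cycle-f
    module H = Orbit h cycle-h

  conj : ℤ → ℤ
  conj x = H.base (F.index x) + (x - F.base (F.index x))

  conj-on-fibre : ∀ y {j} → F.index y ≡ j → conj y ≡ H.base j + (y - F.base j)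
  conj-on-fibre y eq = cong (λ i → H.base i + (y - F.base i)) eq

  conj-base-+* : ∀ j t → conj (F.base j + t * + n) ≡ H.base j + t * + n
  conj-base-+* j t = begin
    conj (F.base j + t * + n)                     ≡⟨ conj-on-fibre (F.base j + t * + n) (F.index-base-+* j t) ⟩
    H.base j + ((F.base j + t * + n) - F.base j)  ≡⟨ cong (_+_ (H.base j)) (add-sub (F.base j) (t * + n)) ⟩
    H.base j + t * + n                            ∎
    where
    add-sub : ∀ a b → (a + b) - a ≡ b
    add-sub = solve-∀

  conj-periodic : ∀ x → conj (x + + n) ≡ conj x + + n
  conj-periodic = F.coordinate-elim (λ x → conj (x + + n) ≡ conj x + + n) λ j t → begin
    conj ((F.base j + t * + n) + + n)   ≡⟨ cong conj (shift (F.base j) t (+ n)) ⟩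
    conj (F.base j + (t + + 1) * + n)   ≡⟨ conj-base-+* j (t + + 1) ⟩
    H.base j + (t + + 1) * + n          ≡⟨ shift (H.base j) t (+ n) ⟨
    (H.base j + t * + n) + + n          ≡⟨ cong (_+ + n) (conj-base-+* j t) ⟨
    conj (F.base j + t * + n) + + n     ∎
    where
    shift : ∀ a t d → (a + t * d) + d ≡ a + (t + + 1) * d
    shift = solve-∀

  module _ (point-n-≡ : F.point n ≡ H.point n) where

    conj-step : ∀ j t → conj (fun f (F.base j) + t * + n) ≡ fun h (H.base j) + t * + n
    conj-step j t with ℕ.m≤n⇒m<n∨m≡n (Fin.toℕ<n j)
    ... | inj₁ lt = begin
      conj (fun f (F.base j) + t * + n)   ≡⟨ cong (λ y → conj (y + t * + n)) (F.base-suc lt) ⟨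
      conj (F.base j′ + t * + n)          ≡⟨ conj-base-+* j′ t ⟩
      H.base j′ + t * + n                 ≡⟨ cong (_+ t * + n) (H.base-suc lt) ⟩
      fun h (H.base j) + t * + n          ∎
      where j′ = fromℕ< lt
    ... | inj₂ j+1≡n = begin
      conj (F.point (suc (toℕ j)) + t * + n)
        ≡⟨ cong (λ k → conj (F.point k + t * + n)) j+1≡n ⟩
      conj (F.point n + t * + n)
        ≡⟨ conj-on-fibre (F.point n + t * + n) (F.index-point-n-+* t) ⟩
      H.base F.origin + ((F.point n + t * + n) - F.base F.origin)
        ≡⟨ cong₂ (λ b a → b + ((F.point n + t * + n) - a)) H.base-origin F.base-origin ⟩
      + 0 + ((F.point n + t * + n) - + 0)
        ≡⟨ drop-zeros (F.point n + t * + n) ⟩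
      F.point n + t * + n
        ≡⟨ cong (_+ t * + n) point-n-≡ ⟩
      H.point n + t * + n
        ≡⟨ cong (λ k → H.point k + t * + n) j+1≡n ⟨
      H.point (suc (toℕ j)) + t * + n     ∎
      where
      drop-zeros : ∀ a → + 0 + (a - + 0) ≡ a
      drop-zeros = solve-∀

    conj-commutes : ∀ x → conj (fun f x) ≡ fun h (conj x)
    conj-commutes = F.coordinate-elim (λ x → conj (fun f x) ≡ fun h (conj x)) λ j t → begin
      conj (fun f (F.base j + t * + n))   ≡⟨ cong conj (fun-+* f (F.base j) t) ⟩
      conj (fun f (F.base j) + t * + n)   ≡⟨ conj-step j t ⟩
      fun h (H.base j) + t * + n          ≡⟨ fun-+* h (H.base j) t ⟨
      fun h (H.base j + t * + n)          ≡⟨ cong (fun h) (conj-base-+* j t) ⟨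
      fun h (conj (F.base j + t * + n))   ∎

conj-inverse : ∀ {n} .{{_ : NonZero n}} (f h : AffinePerm n)
               (cycle-f : IsNCycle (bar f)) (cycle-h : IsNCycle (bar h)) →
               ∀ x → Conjugation.conj h f cycle-h cycle-f (Conjugation.conj f h cycle-f cycle-h x) ≡ x
conj-inverse {n} f h cycle-f cycle-h = F.coordinate-elim (λ x → conj′ (conj x) ≡ x) λ j t → begin
  conj′ (conj (F.base j + t * + n))   ≡⟨ cong conj′ (conj-base-+* j t) ⟩
  conj′ (H.base j + t * + n)          ≡⟨ Conjugation.conj-base-+* h f cycle-h cycle-f j t ⟩
  F.base j + t * + n                  ∎
  where
  open Conjugation f h cycle-f cycle-h using (conj; conj-base-+*)
  conj′ = Conjugation.conj h f cycle-h cycle-f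
  module F = Orbit f cycle-f
  module H = Orbit h cycle-h

nCycle-conjugate : ∀ {n} .{{_ : NonZero n}} (f h : AffinePerm n) →
                   IsNCycle (bar f) → IsNCycle (bar h) →
                   iter (fun f) n (+ 0) ≡ iter (fun h) n (+ 0) → Conjugate f h
nCycle-conjugate f h cycle-f cycle-h point-n-≡ = g , conj-commutes point-n-≡
  where
  open Conjugation f h cycle-f cycle-h using (conj; conj-periodic; conj-commutes)
  g : AffinePerm _
  g = record
    { fun       = conj
    ; inv       = Conjugation.conj h f cycle-h cycle-f
    ; inv-left  = conj-inverse f h cycle-f cycle-h
    ; inv-right = conj-inverse h f cycle-h cycle-f
    ; periodic  = conj-periodic
    }

proposition2p7 : (k n : ℕ) .{{_ : NonZero n}} → 1 ≤ k → k < n →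
    (f h : AffinePerm n) → InTheta k n f → InTheta k n h → Conjugate f h
proposition2p7 k n _ _ f h (_ , sum-f , cycle-f) (_ , sum-h , cycle-h) =
  nCycle-conjugate f h cycle-f cycle-h (begin
    iter (fun f) n (+ 0)                ≡⟨ Orbit.sum-displacement f cycle-f ⟨
    sumFrom1 n (λ i → fun f i - i)      ≡⟨ trans sum-f (sym sum-h) ⟩
    sumFrom1 n (λ i → fun h i - i)      ≡⟨ Orbit.sum-displacement h cycle-h ⟩
    iter (fun h) n (+ 0)                ∎)
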